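{- Let $\mathbf A=\langle A,+,\cdot,{}^{\alpha},0,1\rangle$ and $\mathbf B=\langle B,+,\cdot,{}^{\alpha},0,1\rangle$ be join $\sigma$-complete $\iota$-near semirings such that $\mathrm{Ce}(\mathbf A)$ and $\mathrm{Ce}(\mathbf B)$ are $\sigma$-complete Boolean algebras. If there are $a\in\mathrm{Ce}(\mathbf A)$ and $b\in\mathrm{Ce}(\mathbf B)$ such that $\mathbf A\cong[0,b]$ and $\mathbf B\cong[0,a]$, then $\mathbf A\cong\mathbf B$.
   Context: An $\iota$-near semiring (involutive idempotent integral near semiring) is an algebra $\mathbf A=\langle A,+,\cdot,{}^{\alpha},0,1\rangle$ of type $\langle 2,2,1,0,0\rangle$ such that: (i) $\langle A,+\rangle$ is a join semilattice with least element $0$ and greatest element $1$, with induced order $x\le y$ iff $x+y=y$; (ii) $x\cdot 1=x=1\cdot x$; (iii) $(x+y)\cdot z=(x\cdot z)+(y\cdot z)$; (iv) $x\cdot 0=0\cdot x=0$; (v) $(x^{\alpha})^{\alpha}=x$; (vi) $x\le y$ implies $y^{\alpha}\le x^{\alpha}$. Join $\sigma$-complete means every countable subset of $A$ has a join (supremum) with respect to $\le$. An element $e\in A$ is central if the principal congruences $\theta(e,0)$ and $\theta(e,1)$ form a pair of factor congruences, i.e. $\theta(e,0)\cap\theta(e,1)$ is the identity relation and $\theta(e,0)\circ\theta(e,1)=A\times A$. $\mathrm{Ce}(\mathbf A)$ denotes the set of central elements; it forms a Boolean algebra with meet $\cdot$, join $+$, complement ${}^{\alpha}$, and bounds $0,1$;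 $\sigma$-complete means every countable subset of $\mathrm{Ce}(\mathbf A)$ has a join and a meet in this Boolean algebra. For a central element $e$, $[0,e]=\{x\in A: x\le e\}$ is regarded as an algebra of the same type with operations $x+_e y=e\cdot(x+y)$, $x\cdot_e y=e\cdot(x\cdot y)$, $x^{\alpha_e}=e\cdot x^{\alpha}$ and constants $0$ and $e$. -}

module Defs where

open import Level using (Level; _⊔_; suc)
open import Data.Nat using (ℕ)
open import Data.Product using (Σ; ∃; _×_; _,_)
open import Relation.Binary.PropositionalEquality using (_≡_)

-- ι-near semiring (involutive idempotent integral near semiring),
-- with equality the propositional equality of the carrier.
record INearSemiring (ℓ : Level) : Set (suc ℓ) where
  infixl 6 _+_
  infixl 7 _·_
  infix 4 _≤_
  field
    Carrier : Set ℓ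
    _+_ : Carrier → Carrier → Carrier
    _·_ : Carrier → Carrier → Carrier
    _ᵅ  : Carrier → Carrier
    𝟘 𝟙 : Carrier

  _≤_ : Carrier → Carrier → Set ℓ
  x ≤ y = x + y ≡ y

  field
    +-assoc : ∀ x y z → (x + y) + z ≡ x + (y + z)
    +-comm  : ∀ x y → x + y ≡ y + x
    +-idem  : ∀ x → x + x ≡ x
    𝟘-least    : ∀ x → 𝟘 ≤ x
    𝟙-greatest : ∀ x → x ≤ 𝟙
    ·-identityʳ : ∀ x → x · 𝟙 ≡ x
    ·-identityˡ : ∀ x → 𝟙 · x ≡ x
    ·-distribʳ : ∀ x y z → (x + y) · z ≡ (x · z) + (y · z)
    ·-zeroʳ : ∀ x → x · 𝟘 ≡ 𝟘
    ·-zeroˡ : ∀ x → 𝟘 · x ≡ 𝟘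
    ᵅ-invol : ∀ x → (x ᵅ) ᵅ ≡ x
    ᵅ-antitone : ∀ {x y} → x ≤ y → (y ᵅ) ≤ (x ᵅ)

module _ {ℓ : Level} (A : INearSemiring ℓ) where
  open INearSemiring A

  IsSup : (ℕ → Carrier) → Carrier → Set ℓ
  IsSup f s = (∀ n → f n ≤ s) × (∀ u → (∀ n → f n ≤ u) → s ≤ u)

  -- join σ-complete: every countable subset has a join.
  -- (Countable nonempty subsets = ranges of sequences ℕ → A; the empty
  -- subset always has join 𝟘.)
  JoinσComplete : Set ℓ
  JoinσComplete = ∀ (f : ℕ → Carrier) → ∃ λ s → IsSup f s

  data θ (e d : Carrier) : Carrier → Carrier → Set ℓ where
    θ-gen   : θ e d e d
    θ-refl  : ∀ {x} → θ e d x x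
    θ-sym   : ∀ {x y} → θ e d x y → θ e d y x
    θ-trans : ∀ {x y z} → θ e d x y → θ e d y z → θ e d x z
    θ-+     : ∀ {x y x' y'} → θ e d x x' → θ e d y y' → θ e d (x + y) (x' + y')
    θ-·     : ∀ {x y x' y'} → θ e d x x' → θ e d y y' → θ e d (x · y) (x' · y')
    θ-ᵅ     : ∀ {x x'} → θ e d x x' → θ e d (x ᵅ) (x' ᵅ)

  -- e is central: θ(e,0), θ(e,1) are a pair of factor congruences
  IsCentral : Carrier → Set ℓ
  IsCentral e =
    (∀ x y → θ e 𝟘 x y → θ e 𝟙 x y → x ≡ y) ×
    (∀ x y → ∃ λ z → θ e 𝟘 x z × θ e 𝟙 z y)

  -- Ce(A) is a σ-complete Boolean algebra: every countable family of central
  -- elements has a join and a meet in Ce(A) (whose order is the restriction of ≤).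
  CeσComplete : Set ℓ
  CeσComplete = ∀ (f : ℕ → Carrier) → (∀ n → IsCentral (f n)) →
    (∃ λ s → IsCentral s × (∀ n → f n ≤ s) ×
               (∀ u → IsCentral u → (∀ n → f n ≤ u) → s ≤ u)) ×
    (∃ λ m → IsCentral m × (∀ n → m ≤ f n) ×
               (∀ u → IsCentral u → (∀ n → u ≤ f n) → u ≤ m))

record _≅_ {a b : Level} (A : INearSemiring a) (B : INearSemiring b) : Set (a ⊔ b) where
  private
    module A = INearSemiring A
    module B = INearSemiring B
  field
    to   : A.Carrier → B.Carrier
    from : B.Carrier → A.Carrier
    from∘to : ∀ x → from (to x) ≡ x
    to∘from : ∀ y → to (from y) ≡ y
    to-+ : ∀ x y → to (x A.+ y) ≡ to x B.+ to y
    to-· : ∀ x y → to (x A.· y) ≡ to x B.· to y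
    to-ᵅ : ∀ x → to (x A.ᵅ) ≡ (to x) B.ᵅ
    to-𝟘 : to A.𝟘 ≡ B.𝟘
    to-𝟙 : to A.𝟙 ≡ B.𝟙

-- A ≅ [0,e] for e ∈ B: an isomorphism from A onto the interval algebra
-- ⟨[0,e], +_e, ·_e, ᵅ_e, 0, e⟩ with x +_e y = e·(x+y), x ·_e y = e·(x·y),
-- x^{α_e} = e·x^α.  The interval is represented as the subset {y | y ≤ e}
-- of B: `to` lands in it, `from` is inverse to `to` on it.
record _≅[0,_] {a b : Level} (A : INearSemiring a) {B : INearSemiring b}
                (e : INearSemiring.Carrier B) : Set (a ⊔ b) where
  private
    module A = INearSemiring A
    module B = INearSemiring B
  field
    to   : A.Carrier → B.Carrier
    from : B.Carrier → A.Carrier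
    to-≤e   : ∀ x → to x B.≤ e
    from∘to : ∀ x → from (to x) ≡ x
    to∘from : ∀ y → y B.≤ e → to (from y) ≡ y
    to-+ : ∀ x y → to (x A.+ y) ≡ e B.· (to x B.+ to y)
    to-· : ∀ x y → to (x A.· y) ≡ e B.· (to x B.· to y)
    to-ᵅ : ∀ x → to (x A.ᵅ) ≡ e B.· ((to x) B.ᵅ)
    to-𝟘 : to A.𝟘 ≡ B.𝟘
    to-𝟙 : to A.𝟙 ≡ e

module Submission where

-- A central element e splits every x as e·x + eᵅ·x, and left multiplication by
-- e is a homomorphism onto the interval algebra [0,e].  Identities involving a
-- central e are all proved by one substitution principle (case-split): an
-- identity between polynomials in e holds if it holds for e = 0 and e = 1.
-- Centrality of complements, joins, and of images under the given embeddings
-- is shown by exhibiting compatible kernels that separate points.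
--
-- An embedding A ≅[0,c] is
-- left adjoint to the retraction y ↦ from (c·y); composing the two embeddings
-- gives a Galois connection on A whose σ-Knaster–Tarski fixed point r yields
-- a central s = rᵅ with [0,s] ≅ [0,t] (via A ≅[0,b]) and [0,sᵅ] ≅ [0,tᵅ]
-- (via B ≅[0,a]), for t the image of s.  Gluing these two interval
-- isomorphisms along the factorisations A = [0,s]×[0,sᵅ], B = [0,t]×[0,tᵅ]
-- gives A ≅ B.

open import Level using (Level; _⊔_)
open import Data.Nat using (ℕ; zero; suc)
open import Data.Product using (∃; _×_; _,_; proj₁; proj₂)
open import Relation.Binary.PropositionalEquality
  using (_≡_; refl; sym; trans; cong; cong₂; subst; module ≡-Reasoning)
open import Defs

module Order {ℓ : Level} (N : INearSemiring ℓ) where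
  open INearSemiring N

  +-identityˡ : ∀ x → 𝟘 + x ≡ x
  +-identityˡ = 𝟘-least

  +-identityʳ : ∀ x → x + 𝟘 ≡ x
  +-identityʳ x = trans (+-comm x 𝟘) (𝟘-least x)

  +-zeroˡ : ∀ x → 𝟙 + x ≡ 𝟙
  +-zeroˡ x = trans (+-comm 𝟙 x) (𝟙-greatest x)

  ≤-refl : ∀ x → x ≤ x
  ≤-refl = +-idem

  ≤-trans : ∀ {x y z} → x ≤ y → y ≤ z → x ≤ z
  ≤-trans {x} {y} {z} x≤y y≤z = begin
    x + z        ≡⟨ cong (x +_) (sym y≤z) ⟩
    x + (y + z)  ≡⟨ sym (+-assoc x y z) ⟩
    (x + y) + z  ≡⟨ cong (_+ z) x≤y ⟩
    y + z        ≡⟨ y≤z ⟩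
    z            ∎
    where open ≡-Reasoning

  ≤𝟘 : ∀ {x} → x ≤ 𝟘 → x ≡ 𝟘
  ≤𝟘 {x} x≤𝟘 = trans (sym (+-identityʳ x)) x≤𝟘

  ≤-antisym : ∀ {x y} → x ≤ y → y ≤ x → x ≡ y
  ≤-antisym {x} {y} x≤y y≤x = trans (sym y≤x) (trans (+-comm y x) x≤y)

  x≤x+y : ∀ x y → x ≤ x + y
  x≤x+y x y = trans (sym (+-assoc x x y)) (cong (_+ y) (+-idem x))

  y≤x+y : ∀ x y → y ≤ x + y
  y≤x+y x y = subst (y ≤_) (+-comm y x) (x≤x+y y x)

  +-lub : ∀ {x y z} → x ≤ z → y ≤ z → x + y ≤ z
  +-lub {x} {y} {z} x≤z y≤z = trans (+-assoc x y z) (trans (cong (x +_) y≤z) x≤z)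

  +-mono : ∀ {x x' y y'} → x ≤ x' → y ≤ y' → x + y ≤ x' + y'
  +-mono {x} {x'} {y} {y'} p q =
    +-lub (≤-trans p (x≤x+y x' y')) (≤-trans q (y≤x+y x' y'))

  -- right distributivity makes multiplication monotone in its left argument
  ·-monoˡ : ∀ {x y} z → x ≤ y → x · z ≤ y · z
  ·-monoˡ {x} {y} z x≤y = trans (sym (·-distribʳ x y z)) (cong (_· z) x≤y)

  +-interchange : ∀ x y z w → (x + y) + (z + w) ≡ (x + z) + (y + w)
  +-interchange x y z w = begin
    (x + y) + (z + w)  ≡⟨ +-assoc x y (z + w) ⟩
    x + (y + (z + w))  ≡⟨ cong (x +_) (sym (+-assoc y z w)) ⟩
    x + ((y + z) + w)  ≡⟨ cong (λ u → x + (u + w)) (+-comm y z) ⟩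
    x + ((z + y) + w)  ≡⟨ cong (x +_) (+-assoc z y w) ⟩
    x + (z + (y + w))  ≡⟨ sym (+-assoc x z (y + w)) ⟩
    (x + z) + (y + w)  ∎
    where open ≡-Reasoning

  𝟘ᵅ≡𝟙 : 𝟘 ᵅ ≡ 𝟙
  𝟘ᵅ≡𝟙 = ≤-antisym (𝟙-greatest (𝟘 ᵅ))
    (subst (_≤ 𝟘 ᵅ) (ᵅ-invol 𝟙) (ᵅ-antitone (𝟘-least (𝟙 ᵅ))))

  𝟙ᵅ≡𝟘 : 𝟙 ᵅ ≡ 𝟘
  𝟙ᵅ≡𝟘 = trans (cong _ᵅ (sym 𝟘ᵅ≡𝟙)) (ᵅ-invol 𝟘)

record Compat {ℓ t : Level} (N : INearSemiring ℓ) {T : Set t}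
              (f : INearSemiring.Carrier N → T) : Set (ℓ ⊔ t) where
  open INearSemiring N
  field
    +-cong : ∀ {x y x' y'} → f x ≡ f y → f x' ≡ f y' → f (x + x') ≡ f (y + y')
    ·-cong : ∀ {x y x' y'} → f x ≡ f y → f x' ≡ f y' → f (x · x') ≡ f (y · y')
    ᵅ-cong : ∀ {x y} → f x ≡ f y → f (x ᵅ) ≡ f (y ᵅ)

compat-∘ : ∀ {ℓ ℓ' t} {M : INearSemiring ℓ'} {N : INearSemiring ℓ} {T : Set t}
  {g : INearSemiring.Carrier N → T} (h : INearSemiring.Carrier M → INearSemiring.Carrier N) →
  (∀ x y → h (INearSemiring._+_ M x y) ≡ INearSemiring._+_ N (h x) (h y)) →
  (∀ x y → h (INearSemiring._·_ M x y) ≡ INearSemiring._·_ N (h x) (h y)) →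
  (∀ x → h (INearSemiring._ᵅ M x) ≡ INearSemiring._ᵅ N (h x)) →
  Compat N g → Compat M (λ x → g (h x))
compat-∘ {g = g} h h-+ h-· h-ᵅ G = record
  { +-cong = λ {x} {y} {x'} {y'} p q →
      trans (cong g (h-+ x x')) (trans (G.+-cong p q) (cong g (sym (h-+ y y'))))
  ; ·-cong = λ {x} {y} {x'} {y'} p q →
      trans (cong g (h-· x x')) (trans (G.·-cong p q) (cong g (sym (h-· y y'))))
  ; ᵅ-cong = λ {x} {y} p → trans (cong g (h-ᵅ x)) (trans (G.ᵅ-cong p) (cong g (sym (h-ᵅ y))))
  }
  where
  module G = Compat G

module Congruence {ℓ : Level} (N : INearSemiring ℓ) where
  open INearSemiring N
  open Order N

  θ-≡ : ∀ {e d x y} → x ≡ y → θ N e d x y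
  θ-≡ refl = θ-refl

  θ-least : ∀ {e d e' d' x y} → θ N e' d' e d → θ N e d x y → θ N e' d' x y
  θ-least h θ-gen         = h
  θ-least h θ-refl        = θ-refl
  θ-least h (θ-sym p)     = θ-sym (θ-least h p)
  θ-least h (θ-trans p q) = θ-trans (θ-least h p) (θ-least h q)
  θ-least h (θ-+ p q)     = θ-+ (θ-least h p) (θ-least h q)
  θ-least h (θ-· p q)     = θ-· (θ-least h p) (θ-least h q)
  θ-least h (θ-ᵅ p)       = θ-ᵅ (θ-least h p)

  θ-below : ∀ {e p} → p ≤ e → θ N e 𝟘 p 𝟘
  θ-below {e} {p} p≤e =
    θ-trans (θ-≡ (sym (+-identityʳ p)))
      (θ-trans (θ-+ θ-refl (θ-sym θ-gen)) (θ-trans (θ-≡ p≤e) θ-gen))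

  hom-compat : ∀ {t} {T : Set t} (f : Carrier → T)
    (_⊕_ _⊗_ : T → T → T) (∁ : T → T) →
    (∀ x y → f (x + y) ≡ f x ⊕ f y) → (∀ x y → f (x · y) ≡ f x ⊗ f y) →
    (∀ x → f (x ᵅ) ≡ ∁ (f x)) → Compat N f
  hom-compat f _⊕_ _⊗_ ∁ f-+ f-· f-ᵅ = record
    { +-cong = λ {x} {y} {x'} {y'} p q →
        trans (f-+ x x') (trans (cong₂ _⊕_ p q) (sym (f-+ y y')))
    ; ·-cong = λ {x} {y} {x'} {y'} p q →
        trans (f-· x x') (trans (cong₂ _⊗_ p q) (sym (f-· y y')))
    ; ᵅ-cong = λ {x} {y} p → trans (f-ᵅ x) (trans (cong ∁ p) (sym (f-ᵅ y)))
    }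

  compat-pair : ∀ {s t} {S : Set s} {T : Set t} {f : Carrier → S} {g : Carrier → T} →
    Compat N f → Compat N g → Compat N (λ x → f x , g x)
  compat-pair F G = record
    { +-cong = λ p q → cong₂ _,_ (F.+-cong (cong proj₁ p) (cong proj₁ q))
                                 (G.+-cong (cong proj₂ p) (cong proj₂ q))
    ; ·-cong = λ p q → cong₂ _,_ (F.·-cong (cong proj₁ p) (cong proj₁ q))
                                 (G.·-cong (cong proj₂ p) (cong proj₂ q))
    ; ᵅ-cong = λ p → cong₂ _,_ (F.ᵅ-cong (cong proj₁ p)) (G.ᵅ-cong (cong proj₂ p))
    }
    where
    module F = Compat F
    module G = Compat G

  θ⊆ker : ∀ {t} {T : Set t} {e d} (f : Carrier → T) → Compat N f → f e ≡ f d →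
    ∀ {x y} → θ N e d x y → f x ≡ f y
  θ⊆ker f F fe≡fd θ-gen         = fe≡fd
  θ⊆ker f F fe≡fd θ-refl        = refl
  θ⊆ker f F fe≡fd (θ-sym p)     = sym (θ⊆ker f F fe≡fd p)
  θ⊆ker f F fe≡fd (θ-trans p q) = trans (θ⊆ker f F fe≡fd p) (θ⊆ker f F fe≡fd q)
  θ⊆ker f F fe≡fd (θ-+ p q)     = Compat.+-cong F (θ⊆ker f F fe≡fd p) (θ⊆ker f F fe≡fd q)
  θ⊆ker f F fe≡fd (θ-· p q)     = Compat.·-cong F (θ⊆ker f F fe≡fd p) (θ⊆ker f F fe≡fd q)
  θ⊆ker f F fe≡fd (θ-ᵅ p)       = Compat.ᵅ-cong F (θ⊆ker f F fe≡fd p)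

  -- θ(e,0) ∘ θ(e,1) is always the full relation, witnessed by eᵅ·x + e·y
  θ-permute : ∀ e x y → ∃ λ z → θ N e 𝟘 x z × θ N e 𝟙 z y
  θ-permute e x y = (e ᵅ) · x + e · y , θ-sym at𝟘 , at𝟙
    where
    split : ∀ {d} → θ N e d ((e ᵅ) · x + e · y) ((d ᵅ) · x + d · y)
    split = θ-+ (θ-· (θ-ᵅ θ-gen) θ-refl) (θ-· θ-gen θ-refl)
    at𝟘 : θ N e 𝟘 ((e ᵅ) · x + e · y) x
    at𝟘 = θ-trans split (θ-≡ (trans (cong₂ _+_ (trans (cong (_· x) 𝟘ᵅ≡𝟙) (·-identityˡ x))
                                                (·-zeroˡ y)) (+-identityʳ x)))
    at𝟙 : θ N e 𝟙 ((e ᵅ) · x + e · y) y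
    at𝟙 = θ-trans split (θ-≡ (trans (cong₂ _+_ (trans (cong (_· x) 𝟙ᵅ≡𝟘) (·-zeroˡ x))
                                                (·-identityˡ y)) (+-identityˡ y)))

  central-by-kernels : ∀ {s t} {S : Set s} {T : Set t} e (f₀ : Carrier → S) (f₁ : Carrier → T) →
    Compat N f₀ → Compat N f₁ → f₀ e ≡ f₀ 𝟘 → f₁ e ≡ f₁ 𝟙 →
    (∀ x y → f₀ x ≡ f₀ y → f₁ x ≡ f₁ y → x ≡ y) → IsCentral N e
  central-by-kernels e f₀ f₁ F₀ F₁ e₀ e₁ separates =
    (λ x y p q → separates x y (θ⊆ker f₀ F₀ e₀ p) (θ⊆ker f₁ F₁ e₁ q)) , θ-permute e

  separate : ∀ {e x y} → IsCentral N e → θ N e 𝟘 x y → θ N e 𝟙 x y → x ≡ y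
  separate {x = x} {y} eC = proj₁ eC x y

  -- unary polynomial functions: maps preserving every principal congruence
  Polynomial : (Carrier → Carrier) → Set ℓ
  Polynomial p = ∀ {e d x y} → θ N e d x y → θ N e d (p x) (p y)

  case-split : ∀ {e} → IsCentral N e → (p q : Carrier → Carrier) →
    Polynomial p → Polynomial q → p 𝟘 ≡ q 𝟘 → p 𝟙 ≡ q 𝟙 → p e ≡ q e
  case-split eC p q P Q at𝟘 at𝟙 = separate eC
    (θ-trans (P θ-gen) (θ-trans (θ-≡ at𝟘) (θ-sym (Q θ-gen))))
    (θ-trans (P θ-gen) (θ-trans (θ-≡ at𝟙) (θ-sym (Q θ-gen))))

module Central {ℓ : Level} {N : INearSemiring ℓ} {e : INearSemiring.Carrier N}
               (eC : IsCentral N e) where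
  open INearSemiring N
  open Order N
  open Congruence N

  private
    0· : ∀ x → 𝟘 · x ≡ 𝟘
    0· = ·-zeroˡ
    1· : ∀ x → 𝟙 · x ≡ x
    1· = ·-identityˡ

  scale-+ : ∀ x y → e · (x + y) ≡ e · x + e · y
  scale-+ x y = case-split eC (λ u → u · (x + y)) (λ u → u · x + u · y)
    (λ h → θ-· h θ-refl) (λ h → θ-+ (θ-· h θ-refl) (θ-· h θ-refl))
    (trans (0· _) (sym (trans (cong₂ _+_ (0· x) (0· y)) (+-idem 𝟘))))
    (trans (1· _) (sym (cong₂ _+_ (1· x) (1· y))))

  scale-· : ∀ x y → e · (x · y) ≡ (e · x) · (e · y)
  scale-· x y = case-split eC (λ u → u · (x · y)) (λ u → (u · x) · (u · y))
    (λ h → θ-· h θ-refl) (λ h → θ-· (θ-· h θ-refl) (θ-· h θ-refl))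
    (trans (0· _) (sym (trans (cong (_· (𝟘 · y)) (0· x)) (0· _))))
    (trans (1· _) (sym (cong₂ _·_ (1· x) (1· y))))

  scale-ᵅ : ∀ x → e · (x ᵅ) ≡ e · ((e · x) ᵅ)
  scale-ᵅ x = case-split eC (λ u → u · (x ᵅ)) (λ u → u · ((u · x) ᵅ))
    (λ h → θ-· h θ-refl) (λ h → θ-· h (θ-ᵅ (θ-· h θ-refl)))
    (trans (0· _) (sym (0· _)))
    (trans (1· _) (sym (trans (1· _) (cong _ᵅ (1· x)))))

  scale-ᵅ-under : ∀ c x → e · (c · (x ᵅ)) ≡ e · (c · ((e · x) ᵅ))
  scale-ᵅ-under c x = case-split eC (λ u → u · (c · (x ᵅ))) (λ u → u · (c · ((u · x) ᵅ)))
    (λ h → θ-· h θ-refl) (λ h → θ-· h (θ-· θ-refl (θ-ᵅ (θ-· h θ-refl))))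
    (trans (0· _) (sym (0· _)))
    (trans (1· _) (sym (trans (1· _) (cong (λ v → c · (v ᵅ)) (1· x)))))

  decompose : ∀ x → x ≡ e · x + (e ᵅ) · x
  decompose x = case-split eC (λ _ → x) (λ u → u · x + (u ᵅ) · x)
    (λ _ → θ-refl) (λ h → θ-+ (θ-· h θ-refl) (θ-· (θ-ᵅ h) θ-refl))
    (sym (trans (cong₂ _+_ (0· x) (trans (cong (_· x) 𝟘ᵅ≡𝟙) (1· x))) (+-identityˡ x)))
    (sym (trans (cong₂ _+_ (1· x) (trans (cong (_· x) 𝟙ᵅ≡𝟘) (0· x))) (+-identityʳ x)))

  scale-idem : ∀ x → e · (e · x) ≡ e · x
  scale-idem x = case-split eC (λ u → u · (u · x)) (λ u → u · x)
    (λ h → θ-· h (θ-· h θ-refl)) (λ h → θ-· h θ-refl)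
    (trans (0· _) (sym (0· x))) (1· _)

  idem : e · e ≡ e
  idem = trans (cong (e ·_) (sym (·-identityʳ e))) (trans (scale-idem 𝟙) (·-identityʳ e))

  scale-orthˡ : ∀ x → e · ((e ᵅ) · x) ≡ 𝟘
  scale-orthˡ x = case-split eC (λ u → u · ((u ᵅ) · x)) (λ _ → 𝟘)
    (λ h → θ-· h (θ-· (θ-ᵅ h) θ-refl)) (λ _ → θ-refl)
    (0· _) (trans (1· _) (trans (cong (_· x) 𝟙ᵅ≡𝟘) (0· x)))

  scale-orthʳ : ∀ x → (e ᵅ) · (e · x) ≡ 𝟘
  scale-orthʳ x = case-split eC (λ u → (u ᵅ) · (u · x)) (λ _ → 𝟘)
    (λ h → θ-· (θ-ᵅ h) (θ-· h θ-refl)) (λ _ → θ-refl)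
    (trans (cong ((𝟘 ᵅ) ·_) (0· x)) (·-zeroʳ _)) (trans (cong (_· _) 𝟙ᵅ≡𝟘) (0· _))

  compl-·-self : (e ᵅ) · e ≡ 𝟘
  compl-·-self = trans (cong ((e ᵅ) ·_) (sym (·-identityʳ e))) (scale-orthʳ 𝟙)

  scale-≤ : ∀ x → e · x ≤ x
  scale-≤ x = case-split eC (λ u → u · x + x) (λ _ → x)
    (λ h → θ-+ (θ-· h θ-refl) θ-refl) (λ _ → θ-refl)
    (trans (cong (_+ x) (0· x)) (+-identityˡ x)) (trans (cong (_+ x) (1· x)) (+-idem x))

  scale-≤e : ∀ x → e · x ≤ e
  scale-≤e x = case-split eC (λ u → u · x + u) (λ u → u)
    (λ h → θ-+ (θ-· h θ-refl) h) (λ h → h)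
    (trans (cong (_+ 𝟘) (0· x)) (+-idem 𝟘)) (𝟙-greatest _)

  scale-comm : ∀ c x → e · (c · x) ≡ c · (e · x)
  scale-comm c x = case-split eC (λ u → u · (c · x)) (λ u → c · (u · x))
    (λ h → θ-· h θ-refl) (λ h → θ-· θ-refl (θ-· h θ-refl))
    (trans (0· _) (sym (trans (cong (c ·_) (0· x)) (·-zeroʳ c)))) (trans (1· _) (cong (c ·_) (sym (1· x))))

  scale-absorb : ∀ x → e · (e + x) ≡ e
  scale-absorb x = case-split eC (λ u → u · (u + x)) (λ u → u)
    (λ h → θ-· h (θ-+ h θ-refl)) (λ h → h) (0· _) (trans (1· _) (+-zeroˡ x))

  ·-closed : ∀ {p q} → p ≤ e → p · q ≤ e
  ·-closed {p} {q} p≤e = ≤-trans (·-monoˡ q p≤e) (scale-≤e q)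

  fix-below : ∀ {p} → p ≤ e → e · p ≡ p
  fix-below {p} p≤e = separate eC
    (θ-trans (θ-· θ-gen (θ-below p≤e)) (θ-trans (θ-≡ (0· 𝟘)) (θ-sym (θ-below p≤e))))
    (θ-trans (θ-· θ-gen θ-refl) (θ-≡ (1· p)))

  scale-mono : ∀ {x y} → x ≤ y → e · x ≤ e · y
  scale-mono {x} {y} x≤y = trans (sym (scale-+ x y)) (cong (e ·_) x≤y)

  ≤-scale : ∀ {p q} → p ≤ e → p ≤ q → p ≤ e · q
  ≤-scale {p} {q} p≤e p≤q = subst (_≤ e · q) (fix-below p≤e) (scale-mono p≤q)

  absorb : ∀ {p} q → p ≤ e → p · q ≡ p · (e · q)
  absorb {p} q p≤e = subst (λ v → v · q ≡ v · (e · q)) (fix-below p≤e)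
    (case-split eC (λ u → (u · p) · q) (λ u → (u · p) · (u · q))
      (λ h → θ-· (θ-· h θ-refl) θ-refl) (λ h → θ-· (θ-· h θ-refl) (θ-· h θ-refl))
      (trans (cong (_· q) (0· p)) (trans (0· q) (sym (trans (cong (_· (𝟘 · q)) (0· p)) (0· _)))))
      (cong ((𝟙 · p) ·_) (sym (1· q))))

  compl-below : ∀ {w} → w ≤ e → w ᵅ ≡ (e ᵅ) + e · (w ᵅ)
  compl-below {w} w≤e = subst (λ v → v ᵅ ≡ (e ᵅ) + e · (v ᵅ)) (fix-below w≤e)
    (case-split eC (λ u → (u · w) ᵅ) (λ u → (u ᵅ) + u · ((u · w) ᵅ))
      (λ h → θ-ᵅ (θ-· h θ-refl)) (λ h → θ-+ (θ-ᵅ h) (θ-· h (θ-ᵅ (θ-· h θ-refl))))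
      (trans (cong _ᵅ (0· w)) (sym (trans (cong ((𝟘 ᵅ) +_) (0· _)) (+-identityʳ _))))
      (sym (trans (cong₂ _+_ 𝟙ᵅ≡𝟘 (1· _)) (+-identityˡ _))))

  scale-compat : Compat N (e ·_)
  scale-compat = hom-compat (e ·_) _+_ _·_ (λ u → e · (u ᵅ)) scale-+ scale-· scale-ᵅ

  orth-below : ∀ {q} → q ≤ e ᵅ → e · q ≡ 𝟘
  orth-below {q} q≤eᵅ = ≤𝟘 (subst (e · q ≤_) e·eᵅ≡𝟘 (scale-mono q≤eᵅ))
    where
    e·eᵅ≡𝟘 : e · (e ᵅ) ≡ 𝟘
    e·eᵅ≡𝟘 = trans (cong (λ v → e · v) (sym (·-identityʳ (e ᵅ)))) (scale-orthˡ 𝟙)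

module CentralClosure {ℓ : Level} (N : INearSemiring ℓ) where
  open INearSemiring N
  open Order N
  open Congruence N

  -- θ(eᵅ,0) = θ(e,1) and θ(eᵅ,1) = θ(e,0), so the factor pair just swaps
  compl-central : ∀ {e} → IsCentral N e → IsCentral N (e ᵅ)
  compl-central {e} eC =
    (λ x y p q → separate eC (θ-least eᵅ≈𝟙 q) (θ-least eᵅ≈𝟘 p)) , θ-permute (e ᵅ)
    where
    eᵅ≈𝟙 : θ N e 𝟘 (e ᵅ) 𝟙
    eᵅ≈𝟙 = θ-trans (θ-ᵅ θ-gen) (θ-≡ 𝟘ᵅ≡𝟙)
    eᵅ≈𝟘 : θ N e 𝟙 (e ᵅ) 𝟘
    eᵅ≈𝟘 = θ-trans (θ-ᵅ θ-gen) (θ-≡ 𝟙ᵅ≡𝟘)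

  𝟙-central : IsCentral N 𝟙
  𝟙-central = central-by-kernels 𝟙 (λ _ → 𝟙) (λ x → x)
    (hom-compat (λ _ → 𝟙) (λ _ _ → 𝟙) (λ _ _ → 𝟙) (λ _ → 𝟙) (λ _ _ → refl) (λ _ _ → refl) (λ _ → refl))
    (hom-compat (λ x → x) _+_ _·_ _ᵅ (λ _ _ → refl) (λ _ _ → refl) (λ _ → refl))
    refl refl (λ _ _ _ x≡y → x≡y)

  components : ∀ {e p q} → IsCentral N e → p ≤ e → q ≤ e ᵅ →
    (e · (p + q) ≡ p) × ((e ᵅ) · (p + q) ≡ q)
  components {e} {p} {q} eC p≤e q≤eᵅ =
    trans (E.scale-+ p q) (trans (cong₂ _+_ (E.fix-below p≤e) (E.orth-below q≤eᵅ)) (+-identityʳ p)) ,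
    trans (Eᵅ.scale-+ p q) (trans (cong₂ _+_ (Eᵅ.orth-below p≤eᵅᵅ) (Eᵅ.fix-below q≤eᵅ)) (+-identityˡ q))
    where
    module E = Central eC
    module Eᵅ = Central (compl-central eC)
    p≤eᵅᵅ : p ≤ (e ᵅ) ᵅ
    p≤eᵅᵅ = subst (p ≤_) (sym (ᵅ-invol e)) p≤e

  -- e + f is separated by its components along e, along f and outside both
  +-central : ∀ {e f} → IsCentral N e → IsCentral N f → IsCentral N (e + f)
  +-central {e} {f} eC fC = central-by-kernels (e + f) outside inside
    outside-compat (compat-pair E.scale-compat F.scale-compat)
    outside-e+f inside-e+f separates
    where
    module E = Central eC
    module F = Central fC
    module Eᵅ = Central (compl-central eC)
    module Fᵅ = Central (compl-central fC)

    outside : Carrier → Carrier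
    outside x = (f ᵅ) · ((e ᵅ) · x)

    inside : Carrier → Carrier × Carrier
    inside x = e · x , f · x

    outside-ᵅ : ∀ x → outside (x ᵅ) ≡ (f ᵅ) · ((e ᵅ) · (outside x ᵅ))
    outside-ᵅ x = begin
      (f ᵅ) · ((e ᵅ) · (x ᵅ))                          ≡⟨ cong ((f ᵅ) ·_) (Eᵅ.scale-ᵅ x) ⟩
      (f ᵅ) · ((e ᵅ) · (((e ᵅ) · x) ᵅ))                ≡⟨ sym (Eᵅ.scale-comm (f ᵅ) _) ⟩
      (e ᵅ) · ((f ᵅ) · (((e ᵅ) · x) ᵅ))                ≡⟨ cong ((e ᵅ) ·_) (Fᵅ.scale-ᵅ _) ⟩
      (e ᵅ) · ((f ᵅ) · (((f ᵅ) · ((e ᵅ) · x)) ᵅ))      ≡⟨ Eᵅ.scale-comm (f ᵅ) _ ⟩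
      (f ᵅ) · ((e ᵅ) · (((f ᵅ) · ((e ᵅ) · x)) ᵅ))      ∎
      where open ≡-Reasoning

    outside-compat : Compat N outside
    outside-compat = hom-compat outside _+_ _·_ (λ u → (f ᵅ) · ((e ᵅ) · (u ᵅ)))
      (λ x y → trans (cong ((f ᵅ) ·_) (Eᵅ.scale-+ x y)) (Fᵅ.scale-+ _ _))
      (λ x y → trans (cong ((f ᵅ) ·_) (Eᵅ.scale-· x y)) (Fᵅ.scale-· _ _))
      outside-ᵅ

    outside-e+f : outside (e + f) ≡ outside 𝟘
    outside-e+f = trans
      (case-split eC (λ u → (f ᵅ) · ((u ᵅ) · (u + f))) (λ _ → 𝟘)
        (λ h → θ-· θ-refl (θ-· (θ-ᵅ h) (θ-+ h θ-refl))) (λ _ → θ-refl)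
        (trans (cong (λ v → (f ᵅ) · (v · (𝟘 + f))) 𝟘ᵅ≡𝟙)
          (trans (cong ((f ᵅ) ·_) (trans (·-identityˡ _) (+-identityˡ f)))
            (trans (cong ((f ᵅ) ·_) (sym (·-identityʳ f))) (F.scale-orthʳ 𝟙))))
        (trans (cong (λ v → (f ᵅ) · (v · (𝟙 + f))) 𝟙ᵅ≡𝟘)
          (trans (cong ((f ᵅ) ·_) (·-zeroˡ _)) (·-zeroʳ _))))
      (sym (trans (cong ((f ᵅ) ·_) (·-zeroʳ _)) (·-zeroʳ _)))

    inside-e+f : inside (e + f) ≡ inside 𝟙
    inside-e+f = cong₂ _,_
      (trans (E.scale-absorb f) (sym (·-identityʳ e)))
      (trans (cong (f ·_) (+-comm e f)) (trans (F.scale-absorb e) (sym (·-identityʳ f))))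

    reconstruct : ∀ x → x ≡ e · x + ((e ᵅ) · (f · x) + outside x)
    reconstruct x = begin
      x                                                  ≡⟨ E.decompose x ⟩
      e · x + (e ᵅ) · x                                  ≡⟨ cong (λ v → e · x + (e ᵅ) · v) (F.decompose x) ⟩
      e · x + (e ᵅ) · (f · x + (f ᵅ) · x)                ≡⟨ cong (e · x +_) (Eᵅ.scale-+ _ _) ⟩
      e · x + ((e ᵅ) · (f · x) + (e ᵅ) · ((f ᵅ) · x))    ≡⟨ cong (λ v → e · x + ((e ᵅ) · (f · x) + v)) (Eᵅ.scale-comm (f ᵅ) x) ⟩
      e · x + ((e ᵅ) · (f · x) + outside x)              ∎
      where open ≡-Reasoning

    separates : ∀ x y → outside x ≡ outside y → inside x ≡ inside y → x ≡ y
    separates x y out≡ in≡ = trans (reconstruct x) (trans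
      (cong₂ _+_ (cong proj₁ in≡) (cong₂ (λ u v → (e ᵅ) · u + v) (cong proj₂ in≡) out≡))
      (sym (reconstruct y)))

-- A ≅[0,c] is the case e = 1.
record IntervalIso {a b : Level} (X : INearSemiring a) (e : INearSemiring.Carrier X)
                   (Y : INearSemiring b) (f : INearSemiring.Carrier Y) : Set (a ⊔ b) where
  private
    module X = INearSemiring X
    module Y = INearSemiring Y
  field
    to      : X.Carrier → Y.Carrier
    from    : Y.Carrier → X.Carrier
    to-≤    : ∀ {x} → x X.≤ e → to x Y.≤ f
    from-≤  : ∀ {y} → y Y.≤ f → from y X.≤ e
    from∘to : ∀ {x} → x X.≤ e → from (to x) ≡ x
    to∘from : ∀ {y} → y Y.≤ f → to (from y) ≡ y
    to-+    : ∀ {x x'} → x X.≤ e → x' X.≤ e → to (x X.+ x') ≡ to x Y.+ to x'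
    to-·    : ∀ {x x'} → x X.≤ e → x' X.≤ e → to (x X.· x') ≡ to x Y.· to x'
    to-ᵅ    : ∀ {x} → x X.≤ e → to (e X.· (x X.ᵅ)) ≡ f Y.· (to x Y.ᵅ)
    to-𝟘    : to X.𝟘 ≡ Y.𝟘
    to-top  : to e ≡ f

module IntervalIsoBasics {a b : Level} {X : INearSemiring a} {Y : INearSemiring b}
    {e : INearSemiring.Carrier X} {f : INearSemiring.Carrier Y}
    (eC : IsCentral X e) (fC : IsCentral Y f) (I : IntervalIso X e Y f) where
  private
    module X = INearSemiring X
    module Y = INearSemiring Y
    module OX = Order X
    module OY = Order Y
    module E = Central eC
    module F = Central fC
  open IntervalIso I

  inj : ∀ {x x'} → x X.≤ e → x' X.≤ e → to x ≡ to x' → x ≡ x'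
  inj {x} {x'} x≤e x'≤e p = trans (sym (from∘to x≤e)) (trans (cong from p) (from∘to x'≤e))

  to-mono : ∀ {x x'} → x X.≤ x' → x' X.≤ e → to x Y.≤ to x'
  to-mono {x} {x'} x≤x' x'≤e =
    trans (sym (to-+ (OX.≤-trans x≤x' x'≤e) x'≤e)) (cong to x≤x')

  symmetric : IntervalIso Y f X e
  symmetric = record
    { to = from ; from = to ; to-≤ = from-≤ ; from-≤ = to-≤
    ; from∘to = to∘from ; to∘from = from∘to
    ; to-+ = λ y≤f y'≤f → by-to (OY.+-lub y≤f y'≤f) (OX.+-lub (from-≤ y≤f) (from-≤ y'≤f))
        (trans (to-+ (from-≤ y≤f) (from-≤ y'≤f)) (cong₂ Y._+_ (to∘from y≤f) (to∘from y'≤f)))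
    ; to-· = λ y≤f y'≤f → by-to (F.·-closed y≤f) (E.·-closed (from-≤ y≤f))
        (trans (to-· (from-≤ y≤f) (from-≤ y'≤f)) (cong₂ Y._·_ (to∘from y≤f) (to∘from y'≤f)))
    ; to-ᵅ = λ y≤f → by-to (F.scale-≤e _) (E.scale-≤e _)
        (trans (to-ᵅ (from-≤ y≤f)) (cong (λ v → f Y.· (v Y.ᵅ)) (to∘from y≤f)))
    ; to-𝟘 = by-to (Y.𝟘-least f) (X.𝟘-least e) to-𝟘
    ; to-top = trans (cong from (sym to-top)) (from∘to (OX.≤-refl e))
    }
    where
    by-to : ∀ {y x} → y Y.≤ f → x X.≤ e → to x ≡ y → from y ≡ x
    by-to y≤f x≤e p = inj (from-≤ y≤f) x≤e (trans (to∘from y≤f) (sym p))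

restrict : ∀ {a b} {X : INearSemiring a} {Y : INearSemiring b}
  {e : INearSemiring.Carrier X} {f : INearSemiring.Carrier Y} →
  IsCentral X e → IsCentral Y f → (I : IntervalIso X e Y f) →
  ∀ {e'} → INearSemiring._≤_ X e' e → IntervalIso X e' Y (IntervalIso.to I e')
restrict {X = X} {Y} {e} {f} eC fC I {e'} e'≤e = record
  { to = to ; from = from
  ; to-≤ = λ x≤e' → to-mono x≤e' e'≤e
  ; from-≤ = λ {y} y≤ → subst (from y X.≤_) (from∘to e'≤e) (Inv.to-mono y≤ (to-≤ e'≤e))
  ; from∘to = λ x≤e' → from∘to (below x≤e')
  ; to∘from = λ y≤ → to∘from (OY.≤-trans y≤ (to-≤ e'≤e))
  ; to-+ = λ x≤e' x'≤e' → to-+ (below x≤e') (below x'≤e')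
  ; to-· = λ x≤e' x'≤e' → to-· (below x≤e') (below x'≤e')
  ; to-ᵅ = to-relcompl
  ; to-𝟘 = to-𝟘
  ; to-top = refl
  }
  where
  module X = INearSemiring X
  module Y = INearSemiring Y
  module OY = Order Y
  module E = Central eC
  module F = Central fC
  open IntervalIso I
  open IntervalIsoBasics eC fC I
  module Inv = IntervalIsoBasics fC eC symmetric

  below : ∀ {x} → x X.≤ e' → x X.≤ e
  below x≤e' = Order.≤-trans X x≤e' e'≤e

  -- the relative complement in [0,e'] is the e'-part of that in [0,e]
  to-relcompl : ∀ {x} → x X.≤ e' → to (e' X.· (x X.ᵅ)) ≡ to e' Y.· (to x Y.ᵅ)
  to-relcompl {x} x≤e' = begin
    to (e' X.· (x X.ᵅ))                ≡⟨ cong to (E.absorb (x X.ᵅ) e'≤e) ⟩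
    to (e' X.· (e X.· (x X.ᵅ)))        ≡⟨ to-· e'≤e (E.scale-≤e _) ⟩
    to e' Y.· to (e X.· (x X.ᵅ))       ≡⟨ cong (to e' Y.·_) (to-ᵅ (below x≤e')) ⟩
    to e' Y.· (f Y.· (to x Y.ᵅ))       ≡⟨ sym (F.absorb _ (to-≤ e'≤e)) ⟩
    to e' Y.· (to x Y.ᵅ)               ∎
    where open ≡-Reasoning

-- Gluing: isomorphisms [0,e] ≅ [0,f] and [0,eᵅ] ≅ [0,fᵅ] for central e, f
-- combine into A ≅ B, acting on the two components of an element separately.
module Glue {a b : Level} {A : INearSemiring a} {B : INearSemiring b}
    {e : INearSemiring.Carrier A} {f : INearSemiring.Carrier B}
    (eC : IsCentral A e) (fC : IsCentral B f)
    (I : IntervalIso A e B f) (J : IntervalIso A (INearSemiring._ᵅ A e) B (INearSemiring._ᵅ B f)) where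
  private
    module A = INearSemiring A
    module B = INearSemiring B
    module OB = Order B
    module E = Central eC
    module F = Central fC
    module Eᵅ = Central (CentralClosure.compl-central A eC)
    module Fᵅ = Central (CentralClosure.compl-central B fC)
    module I = IntervalIso I
    module J = IntervalIso J

  glued : A.Carrier → B.Carrier
  glued x = I.to (e A.· x) B.+ J.to ((e A.ᵅ) A.· x)

  unglued : B.Carrier → A.Carrier
  unglued y = I.from (f B.· y) A.+ J.from ((f B.ᵅ) B.· y)

  private
    Ix≤f : ∀ x → I.to (e A.· x) B.≤ f
    Ix≤f x = I.to-≤ (E.scale-≤e x)

    Jx≤fᵅ : ∀ x → J.to ((e A.ᵅ) A.· x) B.≤ f B.ᵅ
    Jx≤fᵅ x = J.to-≤ (Eᵅ.scale-≤e x)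

  glued-in : ∀ x → f B.· glued x ≡ I.to (e A.· x)
  glued-in x = proj₁ (CentralClosure.components B fC (Ix≤f x) (Jx≤fᵅ x))

  glued-out : ∀ x → (f B.ᵅ) B.· glued x ≡ J.to ((e A.ᵅ) A.· x)
  glued-out x = proj₂ (CentralClosure.components B fC (Ix≤f x) (Jx≤fᵅ x))

  unglued∘glued : ∀ x → unglued (glued x) ≡ x
  unglued∘glued x = begin
    I.from (f B.· glued x) A.+ J.from ((f B.ᵅ) B.· glued x)
      ≡⟨ cong₂ (λ u v → I.from u A.+ J.from v) (glued-in x) (glued-out x) ⟩
    I.from (I.to (e A.· x)) A.+ J.from (J.to ((e A.ᵅ) A.· x))
      ≡⟨ cong₂ A._+_ (I.from∘to (E.scale-≤e x)) (J.from∘to (Eᵅ.scale-≤e x)) ⟩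
    e A.· x A.+ (e A.ᵅ) A.· x
      ≡⟨ sym (E.decompose x) ⟩
    x ∎
    where open ≡-Reasoning

  glued-+ : ∀ x y → glued (x A.+ y) ≡ glued x B.+ glued y
  glued-+ x y = begin
    I.to (e A.· (x A.+ y)) B.+ J.to ((e A.ᵅ) A.· (x A.+ y))
      ≡⟨ cong₂ (λ u v → I.to u B.+ J.to v) (E.scale-+ x y) (Eᵅ.scale-+ x y) ⟩
    I.to (e A.· x A.+ e A.· y) B.+ J.to ((e A.ᵅ) A.· x A.+ (e A.ᵅ) A.· y)
      ≡⟨ cong₂ B._+_ (I.to-+ (E.scale-≤e x) (E.scale-≤e y)) (J.to-+ (Eᵅ.scale-≤e x) (Eᵅ.scale-≤e y)) ⟩
    (I.to (e A.· x) B.+ I.to (e A.· y)) B.+ (J.to ((e A.ᵅ) A.· x) B.+ J.to ((e A.ᵅ) A.· y))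
      ≡⟨ OB.+-interchange _ _ _ _ ⟩
    glued x B.+ glued y ∎
    where open ≡-Reasoning

  glued-· : ∀ x y → glued (x A.· y) ≡ glued x B.· glued y
  glued-· x y = begin
    I.to (e A.· (x A.· y)) B.+ J.to ((e A.ᵅ) A.· (x A.· y))
      ≡⟨ cong₂ (λ u v → I.to u B.+ J.to v) (E.scale-· x y) (Eᵅ.scale-· x y) ⟩
    I.to ((e A.· x) A.· (e A.· y)) B.+ J.to (((e A.ᵅ) A.· x) A.· ((e A.ᵅ) A.· y))
      ≡⟨ cong₂ B._+_ (I.to-· (E.scale-≤e x) (E.scale-≤e y)) (J.to-· (Eᵅ.scale-≤e x) (Eᵅ.scale-≤e y)) ⟩
    I.to (e A.· x) B.· I.to (e A.· y) B.+ J.to ((e A.ᵅ) A.· x) B.· J.to ((e A.ᵅ) A.· y)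
      ≡⟨ cong₂ B._+_ (cong (I.to (e A.· x) B.·_) (sym (glued-in y)))
                     (cong (J.to ((e A.ᵅ) A.· x) B.·_) (sym (glued-out y))) ⟩
    I.to (e A.· x) B.· (f B.· glued y) B.+ J.to ((e A.ᵅ) A.· x) B.· ((f B.ᵅ) B.· glued y)
      ≡⟨ sym (cong₂ B._+_ (F.absorb (glued y) (Ix≤f x)) (Fᵅ.absorb (glued y) (Jx≤fᵅ x))) ⟩
    I.to (e A.· x) B.· glued y B.+ J.to ((e A.ᵅ) A.· x) B.· glued y
      ≡⟨ sym (B.·-distribʳ _ _ (glued y)) ⟩
    glued x B.· glued y ∎
    where open ≡-Reasoning

  glued-ᵅ : ∀ x → glued (x A.ᵅ) ≡ glued x B.ᵅ
  glued-ᵅ x = begin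
    I.to (e A.· (x A.ᵅ)) B.+ J.to ((e A.ᵅ) A.· (x A.ᵅ))
      ≡⟨ cong₂ (λ u v → I.to u B.+ J.to v) (E.scale-ᵅ x) (Eᵅ.scale-ᵅ x) ⟩
    I.to (e A.· ((e A.· x) A.ᵅ)) B.+ J.to ((e A.ᵅ) A.· (((e A.ᵅ) A.· x) A.ᵅ))
      ≡⟨ cong₂ B._+_ (I.to-ᵅ (E.scale-≤e x)) (J.to-ᵅ (Eᵅ.scale-≤e x)) ⟩
    f B.· (I.to (e A.· x) B.ᵅ) B.+ (f B.ᵅ) B.· (J.to ((e A.ᵅ) A.· x) B.ᵅ)
      ≡⟨ sym (cong₂ (λ u v → f B.· (u B.ᵅ) B.+ (f B.ᵅ) B.· (v B.ᵅ)) (glued-in x) (glued-out x)) ⟩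
    f B.· ((f B.· glued x) B.ᵅ) B.+ (f B.ᵅ) B.· (((f B.ᵅ) B.· glued x) B.ᵅ)
      ≡⟨ sym (cong₂ B._+_ (F.scale-ᵅ (glued x)) (Fᵅ.scale-ᵅ (glued x))) ⟩
    f B.· (glued x B.ᵅ) B.+ (f B.ᵅ) B.· (glued x B.ᵅ)
      ≡⟨ sym (F.decompose _) ⟩
    glued x B.ᵅ ∎
    where open ≡-Reasoning

  glued-𝟘 : glued A.𝟘 ≡ B.𝟘
  glued-𝟘 = trans (cong₂ (λ u v → I.to u B.+ J.to v) (A.·-zeroʳ e) (A.·-zeroʳ (e A.ᵅ)))
    (trans (cong₂ B._+_ I.to-𝟘 J.to-𝟘) (B.+-idem B.𝟘))

  glued-𝟙 : glued A.𝟙 ≡ B.𝟙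
  glued-𝟙 = begin
    I.to (e A.· A.𝟙) B.+ J.to ((e A.ᵅ) A.· A.𝟙)
      ≡⟨ cong₂ (λ u v → I.to u B.+ J.to v) (A.·-identityʳ e) (A.·-identityʳ (e A.ᵅ)) ⟩
    I.to e B.+ J.to (e A.ᵅ)
      ≡⟨ cong₂ B._+_ (trans I.to-top (sym (B.·-identityʳ f))) (trans J.to-top (sym (B.·-identityʳ (f B.ᵅ)))) ⟩
    f B.· B.𝟙 B.+ (f B.ᵅ) B.· B.𝟙
      ≡⟨ sym (F.decompose B.𝟙) ⟩
    B.𝟙 ∎
    where open ≡-Reasoning

glue : ∀ {a b} {A : INearSemiring a} {B : INearSemiring b}
  {e : INearSemiring.Carrier A} {f : INearSemiring.Carrier B} →
  (eC : IsCentral A e) (fC : IsCentral B f) →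
  IntervalIso A e B f → IntervalIso A (INearSemiring._ᵅ A e) B (INearSemiring._ᵅ B f) → A ≅ B
glue eC fC I J = record
  { to = glued ; from = unglued
  ; from∘to = unglued∘glued
  ; to∘from = Glue.unglued∘glued fC eC (IntervalIsoBasics.symmetric eC fC I)
      (IntervalIsoBasics.symmetric (CentralClosure.compl-central _ eC) (CentralClosure.compl-central _ fC) J)
  ; to-+ = glued-+ ; to-· = glued-· ; to-ᵅ = glued-ᵅ ; to-𝟘 = glued-𝟘 ; to-𝟙 = glued-𝟙
  }
  where
  open Glue eC fC I J

asIntervalIso : ∀ {a b} {X : INearSemiring a} {Y : INearSemiring b} {c : INearSemiring.Carrier Y} →
  IsCentral Y c → _≅[0,_] X {Y} c → IntervalIso X (INearSemiring.𝟙 X) Y c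
asIntervalIso {X = X} {Y} {c} cC I = record
  { to = to ; from = from
  ; to-≤ = λ {x} _ → to-≤e x
  ; from-≤ = λ {y} _ → X.𝟙-greatest (from y)
  ; from∘to = λ {x} _ → from∘to x
  ; to∘from = λ {y} y≤c → to∘from y y≤c
  ; to-+ = λ {x} {x'} _ _ → trans (to-+ x x') (C.fix-below (Order.+-lub Y (to-≤e x) (to-≤e x')))
  ; to-· = λ {x} {x'} _ _ → trans (to-· x x') (C.fix-below (C.·-closed (to-≤e x)))
  ; to-ᵅ = λ {x} _ → trans (cong to (X.·-identityˡ _)) (to-ᵅ x)
  ; to-𝟘 = to-𝟘
  ; to-top = to-𝟙
  }
  where
  module X = INearSemiring X
  module C = Central cC
  open _≅[0,_] I

module Embedding {a b : Level} {X : INearSemiring a} {Y : INearSemiring b}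
    {c : INearSemiring.Carrier Y} (cC : IsCentral Y c) (I : _≅[0,_] X {Y} c) where
  private
    module X = INearSemiring X
    module Y = INearSemiring Y
    module OY = Order Y
    module C = Central cC
    I′ : IntervalIso X X.𝟙 Y c
    I′ = asIntervalIso cC I
    module I′ = IntervalIso I′
    module Fwd = IntervalIsoBasics (CentralClosure.𝟙-central X) cC I′
    module Bwd = IntervalIsoBasics cC (CentralClosure.𝟙-central X) Fwd.symmetric
    module Inv = IntervalIso Fwd.symmetric
  open _≅[0,_] I public using (to; from; to-≤e; from∘to; to∘from; to-ᵅ; to-𝟘; to-𝟙)

  to-hom-+ : ∀ x y → to (x X.+ y) ≡ to x Y.+ to y
  to-hom-+ x y = I′.to-+ (X.𝟙-greatest x) (X.𝟙-greatest y)

  to-hom-· : ∀ x y → to (x X.· y) ≡ to x Y.· to y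
  to-hom-· x y = I′.to-· (X.𝟙-greatest x) (X.𝟙-greatest y)

  retract : Y.Carrier → X.Carrier
  retract y = from (c Y.· y)

  retract∘to : ∀ x → retract (to x) ≡ x
  retract∘to x = trans (cong from (C.fix-below (to-≤e x))) (from∘to x)

  to∘retract : ∀ y → to (retract y) ≡ c Y.· y
  to∘retract y = to∘from _ (C.scale-≤e y)

  retract-𝟘 : retract Y.𝟘 ≡ X.𝟘
  retract-𝟘 = trans (cong retract (sym to-𝟘)) (retract∘to X.𝟘)

  retract-𝟙 : retract Y.𝟙 ≡ X.𝟙
  retract-𝟙 = trans (cong from (trans (Y.·-identityʳ c) (sym to-𝟙))) (from∘to X.𝟙)

  retract-+ : ∀ y z → retract (y Y.+ z) ≡ retract y X.+ retract z
  retract-+ y z = trans (cong from (C.scale-+ y z)) (Inv.to-+ (C.scale-≤e y) (C.scale-≤e z))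

  retract-· : ∀ y z → retract (y Y.· z) ≡ retract y X.· retract z
  retract-· y z = trans (cong from (C.scale-· y z)) (Inv.to-· (C.scale-≤e y) (C.scale-≤e z))

  retract-ᵅ : ∀ y → retract (y Y.ᵅ) ≡ retract y X.ᵅ
  retract-ᵅ y = trans (cong from (C.scale-ᵅ y))
    (trans (Inv.to-ᵅ (C.scale-≤e y)) (X.·-identityˡ _))

  to⊣retract : ∀ {x y} → to x Y.≤ y → x X.≤ retract y
  to⊣retract {x} {y} tx≤y = subst (X._≤ retract y) (from∘to x)
    (Bwd.to-mono (C.≤-scale (to-≤e x) tx≤y) (C.scale-≤e y))

  retract⊢to : ∀ {x y} → x X.≤ retract y → to x Y.≤ y
  retract⊢to {x} {y} x≤ry = OY.≤-trans
    (subst (to x Y.≤_) (to∘retract y) (Fwd.to-mono x≤ry (X.𝟙-greatest _))) (C.scale-≤ y)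

  -- to e is central: it is separated by cᵅ·y, eᵅ·retract y and e·retract y
  to-central : ∀ {e} → IsCentral X e → IsCentral Y (to e)
  to-central {e} eC = Congruence.central-by-kernels Y (to e) outside inside
    (Congruence.compat-pair Y Cᵅ.scale-compat retracted-compat)
    (compat-∘ retract retract-+ retract-· retract-ᵅ E.scale-compat)
    (cong₂ _,_ outside-c outside-e) inside-e separates
    where
    module E = Central eC
    module Eᵅ = Central (CentralClosure.compl-central X eC)
    module Cᵅ = Central (CentralClosure.compl-central Y cC)

    outside : Y.Carrier → Y.Carrier × X.Carrier
    outside y = (c Y.ᵅ) Y.· y , (e X.ᵅ) X.· retract y

    inside : Y.Carrier → X.Carrier
    inside y = e X.· retract y

    retracted-compat : Compat Y (λ y → (e X.ᵅ) X.· retract y)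
    retracted-compat = compat-∘ retract retract-+ retract-· retract-ᵅ Eᵅ.scale-compat

    outside-c : (c Y.ᵅ) Y.· to e ≡ (c Y.ᵅ) Y.· Y.𝟘
    outside-c = trans (cong ((c Y.ᵅ) Y.·_) (sym (C.fix-below (to-≤e e))))
      (trans (C.scale-orthʳ _) (sym (Y.·-zeroʳ _)))

    outside-e : (e X.ᵅ) X.· retract (to e) ≡ (e X.ᵅ) X.· retract Y.𝟘
    outside-e = trans (cong ((e X.ᵅ) X.·_) (retract∘to e))
      (trans E.compl-·-self (sym (trans (cong ((e X.ᵅ) X.·_) retract-𝟘) (X.·-zeroʳ _))))

    inside-e : e X.· retract (to e) ≡ e X.· retract Y.𝟙
    inside-e = trans (cong (e X.·_) (retract∘to e))
      (trans E.idem (sym (trans (cong (e X.·_) retract-𝟙) (X.·-identityʳ e))))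

    separates : ∀ y z → outside y ≡ outside z → inside y ≡ inside z → y ≡ z
    separates y z out≡ in≡ = trans (C.decompose y)
      (trans (cong₂ Y._+_ cy≡cz (cong proj₁ out≡)) (sym (C.decompose z)))
      where
      ry≡rz : retract y ≡ retract z
      ry≡rz = trans (E.decompose _)
        (trans (cong₂ X._+_ in≡ (cong proj₂ out≡)) (sym (E.decompose _)))
      cy≡cz : c Y.· y ≡ c Y.· z
      cy≡cz = trans (sym (to∘retract y)) (trans (cong to ry≡rz) (to∘retract z))

  -- retract w is central: it is separated by w·to x and wᵅ·to x
  retract-central : ∀ {w} → IsCentral Y w → IsCentral X (retract w)
  retract-central {w} wC = Congruence.central-by-kernels X (retract w)
    (λ x → (w Y.ᵅ) Y.· to x) (λ x → w Y.· to x)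
    (component-compat (CentralClosure.compl-central Y wC)) (component-compat wC)
    outside-w inside-w separates
    where
    module W = Central wC
    module Wᵅ = Central (CentralClosure.compl-central Y wC)

    component-compat : ∀ {u} → IsCentral Y u → Compat X (λ x → u Y.· to x)
    component-compat {u} uC = Congruence.hom-compat X (λ x → u Y.· to x) Y._+_ Y._·_
      (λ v → u Y.· (c Y.· (v Y.ᵅ)))
      (λ x y → trans (cong (u Y.·_) (to-hom-+ x y)) (U.scale-+ _ _))
      (λ x y → trans (cong (u Y.·_) (to-hom-· x y)) (U.scale-· _ _))
      (λ x → trans (cong (u Y.·_) (to-ᵅ x)) (U.scale-ᵅ-under c (to x)))
      where module U = Central uC

    outside-w : (w Y.ᵅ) Y.· to (retract w) ≡ (w Y.ᵅ) Y.· to X.𝟘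
    outside-w = trans (cong ((w Y.ᵅ) Y.·_) (to∘retract w))
      (trans (Wᵅ.scale-comm c w) (trans (cong (c Y.·_) W.compl-·-self)
        (trans (Y.·-zeroʳ c) (sym (trans (cong ((w Y.ᵅ) Y.·_) to-𝟘) (Y.·-zeroʳ _))))))

    inside-w : w Y.· to (retract w) ≡ w Y.· to X.𝟙
    inside-w = begin
      w Y.· to (retract w)    ≡⟨ cong (w Y.·_) (to∘retract w) ⟩
      w Y.· (c Y.· w)         ≡⟨ W.scale-comm c w ⟩
      c Y.· (w Y.· w)         ≡⟨ cong (c Y.·_) W.idem ⟩
      c Y.· w                 ≡⟨ cong (c Y.·_) (sym (Y.·-identityʳ w)) ⟩
      c Y.· (w Y.· Y.𝟙)       ≡⟨ sym (W.scale-comm c Y.𝟙) ⟩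
      w Y.· (c Y.· Y.𝟙)       ≡⟨ cong (w Y.·_) (trans (Y.·-identityʳ c) (sym to-𝟙)) ⟩
      w Y.· to X.𝟙            ∎
      where open ≡-Reasoning

    separates : ∀ x y → (w Y.ᵅ) Y.· to x ≡ (w Y.ᵅ) Y.· to y → w Y.· to x ≡ w Y.· to y → x ≡ y
    separates x y out≡ in≡ = Fwd.inj (X.𝟙-greatest x) (X.𝟙-greatest y)
      (trans (W.decompose _) (trans (cong₂ Y._+_ in≡ out≡) (sym (W.decompose _))))

-- A σ-version of the Knaster–Tarski theorem.  Let Ce(A) be σ-complete, d central
-- and k ⊣ j a Galois connection on A whose two maps preserve centrality.  Then
-- the join r in Ce(A) of the iterates d, d + k d, d + k (d + k d), … satisfies
-- r = d + k r: the left adjoint k preserves the join because j r bounds the iterates.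
module FixedPoint {ℓ : Level} {A : INearSemiring ℓ} (ceσ : CeσComplete A)
    {d : INearSemiring.Carrier A} (dC : IsCentral A d)
    (k j : INearSemiring.Carrier A → INearSemiring.Carrier A)
    (k-central : ∀ {x} → IsCentral A x → IsCentral A (k x))
    (j-central : ∀ {y} → IsCentral A y → IsCentral A (j y))
    (k⊣j : ∀ {x y} → INearSemiring._≤_ A (k x) y → INearSemiring._≤_ A x (j y))
    (j⊢k : ∀ {x y} → INearSemiring._≤_ A x (j y) → INearSemiring._≤_ A (k x) y) where
  open INearSemiring A
  open Order A

  k-mono : ∀ {x y} → x ≤ y → k x ≤ k y
  k-mono {x} {y} x≤y = j⊢k (≤-trans x≤y (k⊣j (≤-refl (k y))))

  approx : ℕ → Carrier
  approx zero    = d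
  approx (suc n) = d + k (approx n)

  approx-central : ∀ n → IsCentral A (approx n)
  approx-central zero    = dC
  approx-central (suc n) = CentralClosure.+-central A dC (k-central (approx-central n))

  private
    join : ∃ λ u → IsCentral A u × (∀ n → approx n ≤ u) ×
                   (∀ v → IsCentral A v → (∀ n → approx n ≤ v) → u ≤ v)
    join = proj₁ (ceσ approx approx-central)

  r : Carrier
  r = proj₁ join

  r-central : IsCentral A r
  r-central = proj₁ (proj₂ join)

  approx≤r : ∀ n → approx n ≤ r
  approx≤r = proj₁ (proj₂ (proj₂ join))

  r-least : ∀ u → IsCentral A u → (∀ n → approx n ≤ u) → r ≤ u
  r-least = proj₂ (proj₂ (proj₂ join))

  r≤step : r ≤ d + k r
  r≤step = r-least _ (CentralClosure.+-central A dC (k-central r-central)) bound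
    where
    bound : ∀ n → approx n ≤ d + k r
    bound zero    = x≤x+y d (k r)
    bound (suc n) = +-mono (≤-refl d) (k-mono (approx≤r n))

  kr≤r : k r ≤ r
  kr≤r = j⊢k (r-least (j r) (j-central r-central) bound)
    where
    bound : ∀ n → approx n ≤ j r
    bound n = k⊣j (≤-trans (y≤x+y d (k (approx n))) (approx≤r (suc n)))

  fixed-point : r ≡ d + k r
  fixed-point = ≤-antisym r≤step (+-lub (approx≤r zero) kr≤r)

-- The construction behind Theorem 10.  For G : A ≅[0,b] and H : B ≅[0,a] the
-- map k = H ∘ G on A has the right adjoint j = (retract of G) ∘ (retract of H),
-- so by FixedPoint there is a central r with r = H(bᵅ) + k r.  With s = rᵅ and
-- t = G s one gets tᵅ = bᵅ + G r and hence H(tᵅ) = r: G maps [0,s] onto [0,t]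
-- and H maps [0,tᵅ] onto [0,r] = [0,sᵅ].
module SchroederBernstein {ℓa ℓb : Level} {A : INearSemiring ℓa} {B : INearSemiring ℓb}
    (ceσA : CeσComplete A) {a : INearSemiring.Carrier A} {b : INearSemiring.Carrier B}
    (aC : IsCentral A a) (bC : IsCentral B b)
    (g : _≅[0,_] A {B} b) (h : _≅[0,_] B {A} a) where
  private
    module A = INearSemiring A
    module B = INearSemiring B
    module G = Embedding bC g
    module H = Embedding aC h
  open FixedPoint ceσA (H.to-central (CentralClosure.compl-central B bC))
    (λ x → H.to (G.to x)) (λ y → G.retract (H.retract y))
    (λ xC → H.to-central (G.to-central xC)) (λ yC → G.retract-central (H.retract-central yC))
    (λ p → G.to⊣retract (H.to⊣retract p)) (λ p → H.retract⊢to (G.retract⊢to p))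

  s : A.Carrier
  s = r A.ᵅ

  s-central : IsCentral A s
  s-central = CentralClosure.compl-central A r-central

  t : B.Carrier
  t = G.to s

  t-central : IsCentral B t
  t-central = G.to-central s-central

  H-tᵅ≡r : H.to (t B.ᵅ) ≡ r
  H-tᵅ≡r = begin
    H.to (t B.ᵅ)                           ≡⟨ cong H.to (Central.compl-below bC (G.to-≤e s)) ⟩
    H.to ((b B.ᵅ) B.+ b B.· (t B.ᵅ))       ≡⟨ cong (λ v → H.to ((b B.ᵅ) B.+ v)) (sym (G.to-ᵅ s)) ⟩
    H.to ((b B.ᵅ) B.+ G.to (s A.ᵅ))        ≡⟨ cong (λ v → H.to ((b B.ᵅ) B.+ G.to v)) (A.ᵅ-invol r) ⟩
    H.to ((b B.ᵅ) B.+ G.to r)              ≡⟨ H.to-hom-+ _ _ ⟩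
    H.to (b B.ᵅ) A.+ H.to (G.to r)         ≡⟨ sym fixed-point ⟩
    r                                      ∎
    where open ≡-Reasoning

  G-part : IntervalIso A s B t
  G-part = restrict (CentralClosure.𝟙-central A) bC (asIntervalIso bC g) (A.𝟙-greatest s)

  H-part : IntervalIso A (s A.ᵅ) B (t B.ᵅ)
  H-part = subst (λ v → IntervalIso A v B (t B.ᵅ)) (trans H-tᵅ≡r (sym (A.ᵅ-invol r)))
    (IntervalIsoBasics.symmetric tᵅ-central (H.to-central tᵅ-central)
      (restrict (CentralClosure.𝟙-central B) aC (asIntervalIso aC h) (B.𝟙-greatest (t B.ᵅ))))
    where
    tᵅ-central : IsCentral B (t B.ᵅ)
    tᵅ-central = CentralClosure.compl-central B t-central

-- Theorem 10 (Cantor–Schröder–Bernstein for ι-near semirings): A and B are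
-- glued from the matching factors [0,s] ≅ [0,t] and [0,sᵅ] ≅ [0,tᵅ].
-- Only the σ-completeness of Ce(A) is used.
theorem10 : {ℓa ℓb : Level} (A : INearSemiring ℓa) (B : INearSemiring ℓb) →
    JoinσComplete A → JoinσComplete B → CeσComplete A → CeσComplete B →
    (a : INearSemiring.Carrier A) (b : INearSemiring.Carrier B) →
    IsCentral A a → IsCentral B b →
    _≅[0,_] A {B} b → _≅[0,_] B {A} a → A ≅ B
theorem10 A B _ _ ceσA _ a b aC bC g h = glue s-central t-central G-part H-part
  where open SchroederBernstein ceσA aC bC g h
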